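{- Let $D\in\mathbb{N}$ and let $U$ be a fixed transition function on $\mathcal{M}_D$ as described in the context. Then there exists at least one transitive component of $\mathcal{M}_D$. Moreover, there exists a proper string $s$ such that $U(s,M)$ lies in a transitive component for every $M\in\mathcal{M}_D$ (not necessarily the same transitive component for all $M$).
   Context: For $i\in\mathbb{Z}$ let $A_i=\begin{pmatrix}1&i\\0&1\end{pmatrix}$, $J=\begin{pmatrix}0&1\\1&0\end{pmatrix}$. $\mathcal{M}_D$ is the set of integer $2\times2$ matrices $\begin{pmatrix}\alpha&\beta\\ \gamma&\delta\end{pmatrix}$ of determinant $\pm D$ satisfying one of: (I) $\gamma=0$, $\beta\ge0$, $\alpha,\delta>0$, $\beta<\delta$; (II) $\delta=0$, $\alpha\ge0$, $\beta,\gamma>0$, $\alpha<\gamma$; (III) $\alpha=0$, $\delta\ge0$, $\beta,\gamma>0$, $\delta<\beta$; (IV) $\beta=0$, $\gamma\ge0$, $\alpha,\delta>0$, $\gamma<\alpha$; (V) $\alpha<0$, $\beta,\gamma,\delta>0$, $|\alpha|<\gamma$; (VI) $\beta<0$, $\alpha,\gamma,\delta>0$, $|\beta|<\delta$. For each $M\in\mathcal{M}_D$ and $j\in\mathbb{N}$ there exist $M'\in\mathcal{M}_D$, $m\ge0$, $d_0\ge-1$, $d_1,\dots,d_m\in\mathbb{N}$ with $MJA_j=A_{d_0}JA_{d_1}\cdots JA_{d_m}M'$; fix a function $U$ with $U([j],M)=M'$ satisfying this. A proper string is a finite sequence $[c_1,\dots,c_n]$ of positive integers; extend $U$ by $U(\emptyset,M)=M$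 and $U([c_1,\dots,c_n],M)=U([c_2,\dots,c_n],U([c_1],M))$. A subset $\mathcal{M}'_D\subset\mathcal{M}_D$ is a transitive component if (1) for every proper string $s$ and $M\in\mathcal{M}'_D$, $U(s,M)\in\mathcal{M}'_D$; and (2) for any $M,M'\in\mathcal{M}'_D$ there is a proper string $s$ with $U(s,M)=M'$. -}

module Defs where

open import Data.Nat as ℕ using (ℕ)
open import Data.Integer using (ℤ; +_; -_; _+_; _*_; _-_; _≤_; _<_; ∣_∣; 0ℤ; 1ℤ; -1ℤ)
open import Data.List using (List; []; _∷_; foldr)
open import Data.List.Relation.Unary.All using (All)
open import Data.Product using (Σ; _×_; ∃)
open import Data.Sum using (_⊎_)
open import Relation.Binary.PropositionalEquality using (_≡_)

record Mat : Set where
  constructor mat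
  field
    α β γ δ : ℤ
open Mat public

infixl 7 _⊗_
_⊗_ : Mat → Mat → Mat
mat a b c d ⊗ mat a' b' c' d' =
  mat (a * a' + b * c') (a * b' + b * d') (c * a' + d * c') (c * b' + d * d')

det : Mat → ℤ
det (mat a b c d) = a * d - b * c

I₂ : Mat
I₂ = mat 1ℤ 0ℤ 0ℤ 1ℤ

A : ℤ → Mat
A i = mat 1ℤ i 0ℤ 1ℤ

J : Mat
J = mat 0ℤ 1ℤ 1ℤ 0ℤ

TypeI TypeII TypeIII TypeIV TypeV TypeVI : Mat → Set
TypeI   (mat a b c d) = (c ≡ 0ℤ) × (0ℤ ≤ b) × (0ℤ < a) × (0ℤ < d) × (b < d)
TypeII  (mat a b c d) = (d ≡ 0ℤ) × (0ℤ ≤ a) × (0ℤ < b) × (0ℤ < c) × (a < c)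
TypeIII (mat a b c d) = (a ≡ 0ℤ) × (0ℤ ≤ d) × (0ℤ < b) × (0ℤ < c) × (d < b)
TypeIV  (mat a b c d) = (b ≡ 0ℤ) × (0ℤ ≤ c) × (0ℤ < a) × (0ℤ < d) × (c < a)
TypeV   (mat a b c d) = (a < 0ℤ) × (0ℤ < b) × (0ℤ < c) × (0ℤ < d) × (+ ∣ a ∣ < c)
TypeVI  (mat a b c d) = (b < 0ℤ) × (0ℤ < a) × (0ℤ < c) × (0ℤ < d) × (+ ∣ b ∣ < d)

𝓜 : ℕ → Mat → Set
𝓜 D M = ((det M ≡ + D) ⊎ (det M ≡ - (+ D))) ×
        (TypeI M ⊎ TypeII M ⊎ TypeIII M ⊎ TypeIV M ⊎ TypeV M ⊎ TypeVI M)

JAprod : List ℕ → Mat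
JAprod = foldr (λ d acc → J ⊗ A (+ d) ⊗ acc) I₂

Positive : ℕ → Set
Positive n = 1 ℕ.≤ n

Proper : List ℕ → Set
Proper s = All Positive s

IsTransition : ℕ → (ℕ → Mat → Mat) → Set
IsTransition D U =
  ∀ (j : ℕ) (M : Mat) → Positive j → 𝓜 D M →
    𝓜 D (U j M) ×
    Σ ℤ (λ d0 → Σ (List ℕ) (λ ds →
      (-1ℤ ≤ d0) × All Positive ds ×
      (M ⊗ J ⊗ A (+ j) ≡ A d0 ⊗ JAprod ds ⊗ U j M)))

Ustr : (ℕ → Mat → Mat) → List ℕ → Mat → Mat
Ustr U []      M = M
Ustr U (c ∷ s) M = Ustr U s (U c M)

IsTransitiveComponent : ℕ → (ℕ → Mat → Mat) → (Mat → Set) → Set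
IsTransitiveComponent D U C =
  (∀ M → C M → 𝓜 D M) ×
  (∀ s M → Proper s → C M → C (Ustr U s M)) ×
  (∀ M M' → C M → C M' → Σ (List ℕ) (λ s → Proper s × (Ustr U s M ≡ M')))

{-# OPTIONS --safe #-}
module Submission where

-- Write X ∼ Y when Y = V X for an integer matrix V of determinant ±1. Along a proper string s,
-- U(s, M) ∼ M J A_{s₁} ⋯ J A_{sₙ}, and when det M = ±D the conjugate M A_{Dk} M⁻¹ is integral and
-- unimodular, so M A_{Dk} ∼ M. With J² = 1 this gives every string t a return string r(t), ending in
-- a letter j > 2D, such that the product of the J A_d along t followed by r(t) is absorbed by every M
-- with det M = ±D. A letter j > 2D forces U([j], M) to be of type I: the second rows of
-- M J A_j = A_{d₀} T U([j], M), with T a product of the J A_d, would contradict the size bounds that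
-- matrices of the types II–VI satisfy. Type I matrices are Hermite normal forms, so ∼-related ones
-- are equal; hence U(r(t), U(t, Z)) = Z for every Z of type I, and the orbit of Z is a transitive
-- component. The string [2D + 1] sends every M into one.

open import Defs
open import Data.Nat as ℕ using (ℕ; zero; suc; z≤n; s≤s)
import Data.Nat.Properties as ℕP
import Data.Nat.Tactic.RingSolver as ℕSolver
open import Data.Integer
  using (ℤ; +_; +[1+_]; -[1+_]; -_; _+_; _*_; _-_; _≤_; _<_; ∣_∣; 0ℤ; 1ℤ; -1ℤ; +≤+; -≤+; +<+; nonNegative)
import Data.Integer.Properties as ℤP
open import Data.Integer.Tactic.RingSolver using (solve-∀)
open import Data.List using (List; []; _∷_; _++_; foldr; concatMap)
import Data.List.Properties as Listₚ
open import Data.List.Relation.Unary.All using (All; []; _∷_)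
open import Data.List.Relation.Unary.All.Properties using (++⁺)
open import Data.Product using (Σ; _×_; _,_; proj₁)
open import Data.Sum using (_⊎_; inj₁; inj₂)
open import Data.Empty using (⊥; ⊥-elim)
open import Relation.Binary.PropositionalEquality
  using (_≡_; refl; sym; trans; cong; subst; module ≡-Reasoning)

-- Inequalities are proved by certificates: the difference is written as a polynomial in
-- quantities known to be nonnegative, assembled with ⟨+⟩ and ⟨*⟩, and matched by the ring solver.

infixl 6 _⟨+⟩_
infixl 7 _⟨*⟩_

_⟨+⟩_ : ∀ {x y} → 0ℤ ≤ x → 0ℤ ≤ y → 0ℤ ≤ x + y
_⟨+⟩_ = ℤP.+-mono-≤

_⟨*⟩_ : ∀ {x y} → 0ℤ ≤ x → 0ℤ ≤ y → 0ℤ ≤ x * y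
_⟨*⟩_ {+ m} {+ n} _ _ = subst (0ℤ ≤_) (ℤP.pos-* m n) (+≤+ z≤n)

≤-by : ∀ {x y z} → 0ℤ ≤ z → z ≡ y - x → x ≤ y
≤-by 0≤z refl = ℤP.0≤i-j⇒j≤i 0≤z

<-by : ∀ {x y z} → 0ℤ ≤ z → z ≡ y - x - 1ℤ → x < y
<-by {x} {y} 0≤z refl = ℤP.suc[i]≤j⇒i<j (≤-by 0≤z (shuffle x y))
  where
  shuffle : ∀ x y → y - x - 1ℤ ≡ y - (1ℤ + x)
  shuffle = solve-∀

≤⇒0≤- : ∀ {x y} → x ≤ y → 0ℤ ≤ y - x
≤⇒0≤- = ℤP.i≤j⇒0≤j-i

<⇒0≤-1 : ∀ {x y} → x < y → 0ℤ ≤ y - x - 1ℤ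
<⇒0≤-1 {x} {y} x<y = subst (0ℤ ≤_) (shuffle x y) (≤⇒0≤- (ℤP.i<j⇒suc[i]≤j x<y))
  where
  shuffle : ∀ x y → y - (1ℤ + x) ≡ y - x - 1ℤ
  shuffle = solve-∀

0<⇒1≤ : ∀ {x} → 0ℤ < x → 1ℤ ≤ x
0<⇒1≤ = ℤP.i<j⇒suc[i]≤j

0<⇒0≤-1 : ∀ {x} → 0ℤ < x → 0ℤ ≤ x - 1ℤ
0<⇒0≤-1 0<x = ≤⇒0≤- (0<⇒1≤ 0<x)

1≤⇒0≤ : ∀ {x} → 1ℤ ≤ x → 0ℤ ≤ x
1≤⇒0≤ = ℤP.≤-trans (+≤+ z≤n)

1≰0 : 1ℤ ≤ 0ℤ → ⊥
1≰0 (+≤+ ())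

1≤-* : ∀ {x y} → 1ℤ ≤ x → 1ℤ ≤ y → 1ℤ ≤ x * y
1≤-* {x} {y} 1≤x 1≤y = ≤-by (≤⇒0≤- 1≤x ⟨*⟩ ≤⇒0≤- 1≤y ⟨+⟩ ≤⇒0≤- 1≤x ⟨+⟩ ≤⇒0≤- 1≤y) (expand x y)
  where
  expand : ∀ x y → (x - 1ℤ) * (y - 1ℤ) + (x - 1ℤ) + (y - 1ℤ) ≡ x * y - 1ℤ
  expand = solve-∀

positive-unit : ∀ {x y} → 0ℤ < x → 0ℤ < y → (x * y ≡ 1ℤ) ⊎ (x * y ≡ -1ℤ) → x ≡ 1ℤ
positive-unit {+[1+ m ]} {+[1+ n ]} _ _ (inj₁ xy≡1) = cong +_ (ℕP.m*n≡1⇒m≡1 (suc m) (suc n) (cong ∣_∣ xy≡1))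
positive-unit {+[1+ m ]} {+[1+ n ]} _ _ (inj₂ ())
positive-unit {+ zero}               (+<+ ()) _ _
positive-unit {+[1+ _ ]} {+ zero}    _ (+<+ ()) _

positive-factor : ∀ {v a} → 0ℤ < a → 0ℤ < v * a → 0ℤ < v
positive-factor {v} {a} 0<a 0<va =
  ℤP.*-cancelʳ-<-nonNeg a ⦃ nonNegative (ℤP.<⇒≤ 0<a) ⦄ (subst (_< v * a) (sym (ℤP.*-zeroˡ a)) 0<va)

remainder-unique : ∀ {b b′ d w} → 0ℤ ≤ b → b < d → 0ℤ ≤ b′ → b′ < d → b + w * d ≡ b′ → w ≡ 0ℤ
remainder-unique {w = + zero} _ _ _ _ _ = refl
remainder-unique {b} {b′} {d} {w@(+[1+ _ ])} 0≤b b<d _ b′<d refl =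
  ⊥-elim (ℤP.<⇒≱ b′<d (≤-by (0≤b ⟨+⟩ 0≤w-1 ⟨*⟩ ℤP.≤-trans 0≤b (ℤP.<⇒≤ b<d)) (expand b w d)))
  where
  0≤w-1 : 0ℤ ≤ w - 1ℤ
  0≤w-1 = +≤+ z≤n
  expand : ∀ b w d → b + (w - 1ℤ) * d ≡ b + w * d - d
  expand = solve-∀
remainder-unique {b} {b′} {d} {w@(-[1+ _ ])} 0≤b b<d 0≤b′ _ refl =
  ⊥-elim (ℤP.<⇒≱ (<-by (<⇒0≤-1 b<d ⟨+⟩ 0≤-w-1 ⟨*⟩ ℤP.≤-trans 0≤b (ℤP.<⇒≤ b<d)) (expand b w d)) 0≤b′)
  where
  0≤-w-1 : 0ℤ ≤ - w - 1ℤ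
  0≤-w-1 = +≤+ z≤n
  expand : ∀ b w d → (d - b - 1ℤ) + (- w - 1ℤ) * d ≡ 0ℤ - (b + w * d) - 1ℤ
  expand = solve-∀

mat-cong : ∀ {a b c d a′ b′ c′ d′} → a ≡ a′ → b ≡ b′ → c ≡ c′ → d ≡ d′ → mat a b c d ≡ mat a′ b′ c′ d′
mat-cong refl refl refl refl = refl

⊗-assoc : ∀ X Y Z → (X ⊗ Y) ⊗ Z ≡ X ⊗ (Y ⊗ Z)
⊗-assoc (mat a b c d) (mat e f g h) (mat i j k l) =
  mat-cong (entry a b e f g h i k) (entry a b e f g h j l) (entry c d e f g h i k) (entry c d e f g h j l)
  where
  entry : ∀ a b e f g h i k →
          (a * e + b * g) * i + (a * f + b * h) * k ≡ a * (e * i + f * k) + b * (g * i + h * k)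
  entry = solve-∀

⊗-identityˡ : ∀ X → I₂ ⊗ X ≡ X
⊗-identityˡ (mat a b c d) = mat-cong (top a c) (top b d) (bottom a c) (bottom b d)
  where
  top : ∀ a c → 1ℤ * a + 0ℤ * c ≡ a
  top = solve-∀
  bottom : ∀ a c → 0ℤ * a + 1ℤ * c ≡ c
  bottom = solve-∀

⊗-identityʳ : ∀ X → X ⊗ I₂ ≡ X
⊗-identityʳ (mat a b c d) = mat-cong (left a b) (right a b) (left c d) (right c d)
  where
  left : ∀ a b → a * 1ℤ + b * 0ℤ ≡ a
  left = solve-∀
  right : ∀ a b → a * 0ℤ + b * 1ℤ ≡ b
  right = solve-∀

det-⊗ : ∀ X Y → det (X ⊗ Y) ≡ det X * det Y
det-⊗ (mat a b c d) (mat e f g h) = cauchy-binet a b c d e f g h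
  where
  cauchy-binet : ∀ a b c d e f g h →
    (a * e + b * g) * (c * f + d * h) - (a * f + b * h) * (c * e + d * g) ≡ (a * d - b * c) * (e * h - f * g)
  cauchy-binet = solve-∀

A-+ : ∀ i k → A i ⊗ A k ≡ A (i + k)
A-+ i k = mat-cong (diagonal i) (sum i k) refl refl
  where
  diagonal : ∀ i → 1ℤ * 1ℤ + i * 0ℤ ≡ 1ℤ
  diagonal = solve-∀
  sum : ∀ i k → 1ℤ * k + i * 1ℤ ≡ i + k
  sum = solve-∀

det-A : ∀ i → det (A i) ≡ 1ℤ
det-A i = unipotent i
  where
  unipotent : ∀ i → 1ℤ * 1ℤ - i * 0ℤ ≡ 1ℤ
  unipotent = solve-∀

Sign : ℤ → Set
Sign e = (e ≡ 1ℤ) ⊎ (e ≡ -1ℤ)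

Unimodular : Mat → Set
Unimodular V = Sign (det V)

Det± : ℕ → Mat → Set
Det± D X = (det X ≡ + D) ⊎ (det X ≡ - (+ D))

sign-* : ∀ {e f} → Sign e → Sign f → Sign (e * f)
sign-* (inj₁ refl) (inj₁ refl) = inj₁ refl
sign-* (inj₁ refl) (inj₂ refl) = inj₂ refl
sign-* (inj₂ refl) (inj₁ refl) = inj₂ refl
sign-* (inj₂ refl) (inj₂ refl) = inj₁ refl

unimodular-⊗ : ∀ {V W} → Unimodular V → Unimodular W → Unimodular (V ⊗ W)
unimodular-⊗ {V} {W} uV uW = subst Sign (sym (det-⊗ V W)) (sign-* uV uW)

unimodular-A : ∀ i → Unimodular (A i)
unimodular-A i = inj₁ (det-A i)

unimodular-J : Unimodular J
unimodular-J = inj₂ refl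

unimodular-JAprod : ∀ ds → Unimodular (JAprod ds)
unimodular-JAprod []       = inj₁ refl
unimodular-JAprod (d ∷ ds) =
  unimodular-⊗ {J ⊗ A (+ d)} {JAprod ds} (unimodular-⊗ {J} {A (+ d)} unimodular-J (unimodular-A (+ d)))
               (unimodular-JAprod ds)

Det±-⊗ : ∀ {D X V} → Det± D X → Unimodular V → Det± D (X ⊗ V)
Det±-⊗ {D} {X} {V} dX uV = subst (λ x → (x ≡ + D) ⊎ (x ≡ - (+ D))) (sym (det-⊗ X V)) (scale dX uV)
  where
  scale : ∀ {x e} → (x ≡ + D) ⊎ (x ≡ - (+ D)) → Sign e → (x * e ≡ + D) ⊎ (x * e ≡ - (+ D))
  scale {x} (inj₁ refl) (inj₁ refl) = inj₁ (ℤP.*-identityʳ x)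
  scale {x} (inj₁ refl) (inj₂ refl) = inj₂ (trans (ℤP.*-comm x -1ℤ) (ℤP.-1*i≡-i x))
  scale {x} (inj₂ refl) (inj₁ refl) = inj₂ (ℤP.*-identityʳ x)
  scale {x} (inj₂ refl) (inj₂ refl) =
    inj₁ (trans (trans (ℤP.*-comm x -1ℤ) (ℤP.-1*i≡-i x)) (ℤP.neg-involutive (+ D)))

Det±-positive : ∀ {D x} → (x ≡ + D) ⊎ (x ≡ - (+ D)) → 1ℤ ≤ x → + D ≡ x
Det±-positive     (inj₁ x≡D)  _    = sym x≡D
Det±-positive {D} (inj₂ refl) 1≤-D = ⊥-elim (1≰0 (ℤP.≤-trans 1≤-D (ℤP.neg-≤-pos {D} {0})))

Det±-negative : ∀ {D x} → (x ≡ + D) ⊎ (x ≡ - (+ D)) → 1ℤ ≤ - x → + D ≡ - x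
Det±-negative {D} (inj₁ refl) 1≤-D = ⊥-elim (1≰0 (ℤP.≤-trans 1≤-D (ℤP.neg-≤-pos {D} {0})))
Det±-negative {D} (inj₂ refl) _    = sym (ℤP.neg-involutive (+ D))

infix 4 _∼_
_∼_ : Mat → Mat → Set
X ∼ Y = Σ Mat λ V → Unimodular V × (V ⊗ X ≡ Y)

∼-reflexive : ∀ {X Y} → X ≡ Y → X ∼ Y
∼-reflexive {X} refl = I₂ , inj₁ refl , ⊗-identityˡ X

∼-refl : ∀ {X} → X ∼ X
∼-refl = ∼-reflexive refl

∼-trans : ∀ {X Y Z} → X ∼ Y → Y ∼ Z → X ∼ Z
∼-trans {X} (V , uV , refl) (W , uW , refl) = W ⊗ V , unimodular-⊗ {W} uW uV , ⊗-assoc W V X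

∼-⊗ʳ : ∀ {X Y} Q → X ∼ Y → X ⊗ Q ∼ Y ⊗ Q
∼-⊗ʳ {X} Q (V , uV , refl) = V , uV , sym (⊗-assoc V X Q)

module ∼-Reasoning where
  open import Relation.Binary.Reasoning.Base.Single _∼_ ∼-refl ∼-trans public

-- With X = (a b; c d): X A_{det X · k} X⁻¹ = 1 + k N for the nilpotent N = (−ac a²; −c² ac),
-- whose inverse 1 − k N is the witness.
⊗A-det-multiple : ∀ X k → X ⊗ A (det X * k) ∼ X
⊗A-det-multiple (mat a b c d) k =
  mat (1ℤ + k * a * c) (- (k * a * a)) (k * c * c) (1ℤ - k * a * c) ,
  inj₁ (det-one a c k) ,
  mat-cong (eα a b c d k) (eβ a b c d k) (eγ a b c d k) (eδ a b c d k)
  where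
  det-one : ∀ a c k → (1ℤ + k * a * c) * (1ℤ - k * a * c) - (- (k * a * a)) * (k * c * c) ≡ 1ℤ
  det-one = solve-∀
  eα : ∀ a b c d k → (1ℤ + k * a * c) * (a * 1ℤ + b * 0ℤ) + (- (k * a * a)) * (c * 1ℤ + d * 0ℤ) ≡ a
  eα = solve-∀
  eβ : ∀ a b c d k → (1ℤ + k * a * c) * (a * ((a * d - b * c) * k) + b * 1ℤ)
                     + (- (k * a * a)) * (c * ((a * d - b * c) * k) + d * 1ℤ) ≡ b
  eβ = solve-∀
  eγ : ∀ a b c d k → (k * c * c) * (a * 1ℤ + b * 0ℤ) + (1ℤ - k * a * c) * (c * 1ℤ + d * 0ℤ) ≡ c
  eγ = solve-∀
  eδ : ∀ a b c d k → (k * c * c) * (a * ((a * d - b * c) * k) + b * 1ℤ)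
                     + (1ℤ - k * a * c) * (c * ((a * d - b * c) * k) + d * 1ℤ) ≡ d
  eδ = solve-∀

⊗A-multiple : ∀ {D X} → Det± D X → ∀ k → X ⊗ A (+ (D ℕ.* k)) ∼ X
⊗A-multiple {D} {X} (inj₁ det≡D) k =
  subst (λ m → X ⊗ A m ∼ X) (trans (cong (_* + k) det≡D) (sym (ℤP.pos-* D k))) (⊗A-det-multiple X (+ k))
⊗A-multiple {D} {X} (inj₂ det≡-D) k =
  subst (λ m → X ⊗ A m ∼ X) (trans (cong (_* - + k) det≡-D) (trans (neg-*-neg (+ D) (+ k)) (sym (ℤP.pos-* D k))))
        (⊗A-det-multiple X (- + k))
  where
  neg-*-neg : ∀ x y → (- x) * (- y) ≡ x * y
  neg-*-neg = solve-∀

prod : List Mat → Mat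
prod = foldr _⊗_ I₂

⊗-prod-++ : ∀ X ws vs → X ⊗ prod (ws ++ vs) ≡ (X ⊗ prod ws) ⊗ prod vs
⊗-prod-++ X []       vs = cong (_⊗ prod vs) (sym (⊗-identityʳ X))
⊗-prod-++ X (w ∷ ws) vs = begin
  X ⊗ (w ⊗ prod (ws ++ vs))       ≡⟨ sym (⊗-assoc X w (prod (ws ++ vs))) ⟩
  (X ⊗ w) ⊗ prod (ws ++ vs)       ≡⟨ ⊗-prod-++ (X ⊗ w) ws vs ⟩
  ((X ⊗ w) ⊗ prod ws) ⊗ prod vs   ≡⟨ cong (_⊗ prod vs) (⊗-assoc X w (prod ws)) ⟩
  (X ⊗ (w ⊗ prod ws)) ⊗ prod vs   ∎
  where open ≡-Reasoning

prod-++ : ∀ ws vs → prod (ws ++ vs) ≡ prod ws ⊗ prod vs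
prod-++ ws vs = begin
  prod (ws ++ vs)              ≡⟨ sym (⊗-identityˡ (prod (ws ++ vs))) ⟩
  I₂ ⊗ prod (ws ++ vs)         ≡⟨ ⊗-prod-++ I₂ ws vs ⟩
  (I₂ ⊗ prod ws) ⊗ prod vs     ≡⟨ cong (_⊗ prod vs) (⊗-identityˡ (prod ws)) ⟩
  prod ws ⊗ prod vs            ∎
  where open ≡-Reasoning

prod-infix : ∀ ws us us′ vs → prod us ≡ prod us′ → prod (ws ++ us ++ vs) ≡ prod (ws ++ us′ ++ vs)
prod-infix []       us us′ vs eq = begin
  prod (us ++ vs)       ≡⟨ prod-++ us vs ⟩
  prod us ⊗ prod vs     ≡⟨ cong (_⊗ prod vs) eq ⟩
  prod us′ ⊗ prod vs    ≡⟨ sym (prod-++ us′ vs) ⟩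
  prod (us′ ++ vs)      ∎
  where open ≡-Reasoning
prod-infix (w ∷ ws) us us′ vs eq = cong (w ⊗_) (prod-infix ws us us′ vs eq)

unimodular-prod : ∀ {ws} → All Unimodular ws → Unimodular (prod ws)
unimodular-prod []                  = inj₁ refl
unimodular-prod {w ∷ ws} (uw ∷ uws) = unimodular-⊗ {w} {prod ws} uw (unimodular-prod uws)

Absorbed : ℕ → List Mat → Set
Absorbed D us = ∀ X → Det± D X → X ⊗ prod us ∼ X

absorbed-infix : ∀ {D} X ws us vs → Absorbed D us → Det± D X → All Unimodular ws →
                 X ⊗ prod (ws ++ us ++ vs) ∼ X ⊗ prod (ws ++ vs)
absorbed-infix X ws us vs absorbed dX uws = begin
  X ⊗ prod (ws ++ us ++ vs)               ≡⟨ ⊗-prod-++ X ws (us ++ vs) ⟩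
  (X ⊗ prod ws) ⊗ prod (us ++ vs)         ≡⟨ ⊗-prod-++ (X ⊗ prod ws) us vs ⟩
  ((X ⊗ prod ws) ⊗ prod us) ⊗ prod vs     ∼⟨ ∼-⊗ʳ (prod vs) (absorbed (X ⊗ prod ws) dXws) ⟩
  (X ⊗ prod ws) ⊗ prod vs                 ≡⟨ sym (⊗-prod-++ X ws vs) ⟩
  X ⊗ prod (ws ++ vs)                     ∎
  where
  open ∼-Reasoning
  dXws = Det±-⊗ {X = X} dX (unimodular-prod uws)

A-multiple-absorbed : ∀ {D} k → Absorbed D (A (+ (D ℕ.* k)) ∷ [])
A-multiple-absorbed {D} k X dX =
  subst (_∼ X) (cong (X ⊗_) (sym (⊗-identityʳ (A (+ (D ℕ.* k)))))) (⊗A-multiple dX k)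

JA : ℕ → List Mat
JA d = J ∷ A (+ d) ∷ []

JAword : List ℕ → List Mat
JAword = concatMap JA

JAword-++ : ∀ s t → JAword (s ++ t) ≡ JAword s ++ JAword t
JAword-++ = Listₚ.concatMap-++ JA

multiples-absorbed : ∀ {D} m n → Absorbed D (JAword (D ℕ.* m ∷ D ℕ.* n ∷ []))
multiples-absorbed {D} m n X dX = begin
  X ⊗ prod (J ∷ A (+ (D ℕ.* m)) ∷ J ∷ A (+ (D ℕ.* n)) ∷ [])
    ∼⟨ absorbed-infix X (J ∷ []) (A (+ (D ℕ.* m)) ∷ []) (J ∷ A (+ (D ℕ.* n)) ∷ [])
                      (A-multiple-absorbed m) dX (unimodular-J ∷ []) ⟩
  X ⊗ prod (J ∷ J ∷ A (+ (D ℕ.* n)) ∷ [])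
    ≡⟨ cong (X ⊗_) (prod-infix [] (J ∷ J ∷ []) [] (A (+ (D ℕ.* n)) ∷ []) refl) ⟩
  X ⊗ prod (A (+ (D ℕ.* n)) ∷ [])
    ∼⟨ A-multiple-absorbed n X dX ⟩
  X ∎
  where open ∼-Reasoning

Bounded : ℕ → Mat → Set
Bounded D (mat a b c d) = (b ≤ + D) × (d ≤ + D) × (1ℤ ≤ c) × (1ℤ ≤ a + c)

antidiagonal-b≤D : ∀ {D a b c d} → Det± D (mat a b c d) → a * d ≡ 0ℤ → 0ℤ < b → 0ℤ < c → b ≤ + D
antidiagonal-b≤D {D} {a} {b} {c} {d} dY ad≡0 0<b 0<c =
  ≤-by (ℤP.<⇒≤ 0<b ⟨*⟩ 0<⇒0≤-1 0<c) (trans (expand b c) (cong (_- b) (sym D≡bc)))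
  where
  -det≡bc : - (a * d - b * c) ≡ b * c
  -det≡bc = trans (cong (λ z → - (z - b * c)) ad≡0) (negate b c)
    where
    negate : ∀ b c → - (0ℤ - b * c) ≡ b * c
    negate = solve-∀
  D≡bc : + D ≡ b * c
  D≡bc = trans (Det±-negative dY (subst (1ℤ ≤_) (sym -det≡bc) (1≤-* (0<⇒1≤ 0<b) (0<⇒1≤ 0<c)))) -det≡bc
  expand : ∀ b c → b * (c - 1ℤ) ≡ b * c - b
  expand = solve-∀

typeII⇒bounded : ∀ {D a b c d} → Det± D (mat a b c d) → TypeII (mat a b c d) → Bounded D (mat a b c d)
typeII⇒bounded {a = a} dY (refl , 0≤a , 0<b , 0<c , _) =
  antidiagonal-b≤D {a = a} {d = 0ℤ} dY (ℤP.*-zeroʳ a) 0<b 0<c , +≤+ z≤n ,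
  0<⇒1≤ 0<c , ℤP.+-mono-≤ 0≤a (0<⇒1≤ 0<c)

typeIII⇒bounded : ∀ {D a b c d} → Det± D (mat a b c d) → TypeIII (mat a b c d) → Bounded D (mat a b c d)
typeIII⇒bounded {d = d} dY (refl , _ , 0<b , 0<c , d<b) =
  b≤D , ℤP.≤-trans (ℤP.<⇒≤ d<b) b≤D , 0<⇒1≤ 0<c , ℤP.+-mono-≤ (+≤+ z≤n) (0<⇒1≤ 0<c)
  where
  b≤D = antidiagonal-b≤D {a = 0ℤ} {d = d} dY refl 0<b 0<c

typeIV⇒typeI⊎bounded : ∀ {D a b c d} → Det± D (mat a b c d) → TypeIV (mat a b c d) →
                       TypeI (mat a b c d) ⊎ Bounded D (mat a b c d)
typeIV⇒typeI⊎bounded {c = + zero} _ (refl , _ , 0<a , 0<d , _) = inj₁ (refl , +≤+ z≤n , 0<a , 0<d , 0<d)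
typeIV⇒typeI⊎bounded {D} {a} {c = c@(+[1+ _ ])} {d = d} dY (refl , _ , 0<a , 0<d , _) =
  inj₂ (+≤+ z≤n , d≤D , +≤+ (s≤s z≤n) , ℤP.+-mono-≤ (0<⇒1≤ 0<a) (+≤+ z≤n))
  where
  det≡ad : ∀ a c d → a * d - 0ℤ * c ≡ a * d
  det≡ad = solve-∀
  D≡ad : + D ≡ a * d
  D≡ad = trans (Det±-positive dY (subst (1ℤ ≤_) (sym (det≡ad a c d)) (1≤-* (0<⇒1≤ 0<a) (0<⇒1≤ 0<d))))
               (det≡ad a c d)
  d≤D : d ≤ + D
  d≤D = ≤-by (0<⇒0≤-1 0<a ⟨*⟩ ℤP.<⇒≤ 0<d) (trans (expand a d) (cong (_- d) (sym D≡ad)))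
    where
    expand : ∀ a d → (a - 1ℤ) * d ≡ a * d - d
    expand = solve-∀

typeV⇒bounded : ∀ {D a b c d} → Det± D (mat a b c d) → TypeV (mat a b c d) → Bounded D (mat a b c d)
typeV⇒bounded {D} {a@(-[1+ _ ])} {b} {c} {d} dY (_ , 0<b , 0<c , 0<d , ∣a∣<c) =
  b≤D , d≤D , 0<⇒1≤ 0<c , ≤-by (<⇒0≤-1 ∣a∣<c) (shift a c)
  where
  0≤-a : 0ℤ ≤ - a
  0≤-a = +≤+ z≤n
  0≤-a-1 : 0ℤ ≤ - a - 1ℤ
  0≤-a-1 = +≤+ z≤n
  D≡-det : + D ≡ - (a * d - b * c)
  D≡-det = Det±-negative dY (≤-by (≤⇒0≤- (1≤-* (0<⇒1≤ 0<b) (0<⇒1≤ 0<c)) ⟨+⟩ 0≤-a ⟨*⟩ ℤP.<⇒≤ 0<d)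
                                  (expand a b c d))
    where
    expand : ∀ a b c d → (b * c - 1ℤ) + (- a) * d ≡ - (a * d - b * c) - 1ℤ
    expand = solve-∀
  b≤D : b ≤ + D
  b≤D = ≤-by (ℤP.<⇒≤ 0<b ⟨*⟩ 0<⇒0≤-1 0<c ⟨+⟩ 0≤-a ⟨*⟩ ℤP.<⇒≤ 0<d)
             (trans (expand a b c d) (cong (_- b) (sym D≡-det)))
    where
    expand : ∀ a b c d → b * (c - 1ℤ) + (- a) * d ≡ - (a * d - b * c) - b
    expand = solve-∀
  d≤D : d ≤ + D
  d≤D = ≤-by (ℤP.<⇒≤ 0<b ⟨*⟩ ℤP.<⇒≤ 0<c ⟨+⟩ 0≤-a-1 ⟨*⟩ ℤP.<⇒≤ 0<d)
             (trans (expand a b c d) (cong (_- d) (sym D≡-det)))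
    where
    expand : ∀ a b c d → b * c + (- a - 1ℤ) * d ≡ - (a * d - b * c) - d
    expand = solve-∀
  shift : ∀ a c → c - (- a) - 1ℤ ≡ a + c - 1ℤ
  shift = solve-∀
typeV⇒bounded {a = + _} _ (+<+ () , _)

typeVI⇒bounded : ∀ {D a b c d} → Det± D (mat a b c d) → TypeVI (mat a b c d) → Bounded D (mat a b c d)
typeVI⇒bounded {D} {a} {b@(-[1+ _ ])} {c} {d} dY (_ , 0<a , 0<c , 0<d , _) =
  -≤+ , d≤D , 0<⇒1≤ 0<c , ℤP.+-mono-≤ (0<⇒1≤ 0<a) (ℤP.<⇒≤ 0<c)
  where
  0≤-b : 0ℤ ≤ - b
  0≤-b = +≤+ z≤n
  D≡det : + D ≡ a * d - b * c
  D≡det = Det±-positive dY (≤-by (≤⇒0≤- (1≤-* (0<⇒1≤ 0<a) (0<⇒1≤ 0<d)) ⟨+⟩ 0≤-b ⟨*⟩ ℤP.<⇒≤ 0<c)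
                                (expand a b c d))
    where
    expand : ∀ a b c d → (a * d - 1ℤ) + (- b) * c ≡ a * d - b * c - 1ℤ
    expand = solve-∀
  d≤D : d ≤ + D
  d≤D = ≤-by (ℤP.<⇒≤ 0<d ⟨*⟩ 0<⇒0≤-1 0<a ⟨+⟩ 0≤-b ⟨*⟩ ℤP.<⇒≤ 0<c)
             (trans (expand a b c d) (cong (_- d) (sym D≡det)))
    where
    expand : ∀ a b c d → d * (a - 1ℤ) + (- b) * c ≡ a * d - b * c - d
    expand = solve-∀
typeVI⇒bounded {b = + _} _ (+<+ () , _)

𝓜⇒typeI⊎bounded : ∀ {D Y} → 𝓜 D Y → TypeI Y ⊎ Bounded D Y
𝓜⇒typeI⊎bounded {Y = mat _ _ _ _} (_  , inj₁ tI)                             = inj₁ tI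
𝓜⇒typeI⊎bounded {Y = mat _ _ _ _} (dY , inj₂ (inj₁ tII))                     = inj₂ (typeII⇒bounded dY tII)
𝓜⇒typeI⊎bounded {Y = mat _ _ _ _} (dY , inj₂ (inj₂ (inj₁ tIII)))             = inj₂ (typeIII⇒bounded dY tIII)
𝓜⇒typeI⊎bounded {Y = mat _ _ _ _} (dY , inj₂ (inj₂ (inj₂ (inj₁ tIV))))       = typeIV⇒typeI⊎bounded dY tIV
𝓜⇒typeI⊎bounded {Y = mat _ _ _ _} (dY , inj₂ (inj₂ (inj₂ (inj₂ (inj₁ tV))))) = inj₂ (typeV⇒bounded dY tV)
𝓜⇒typeI⊎bounded {Y = mat _ _ _ _} (dY , inj₂ (inj₂ (inj₂ (inj₂ (inj₂ tVI))))) = inj₂ (typeVI⇒bounded dY tVI)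

𝓜⇒0≤γ : ∀ {D M} → 𝓜 D M → 0ℤ ≤ Mat.γ M
𝓜⇒0≤γ {M = mat _ _ _ _} (_ , inj₁ (refl , _))                                    = +≤+ z≤n
𝓜⇒0≤γ {M = mat _ _ _ _} (_ , inj₂ (inj₁ (_ , _ , _ , 0<γ , _)))                  = ℤP.<⇒≤ 0<γ
𝓜⇒0≤γ {M = mat _ _ _ _} (_ , inj₂ (inj₂ (inj₁ (_ , _ , _ , 0<γ , _))))           = ℤP.<⇒≤ 0<γ
𝓜⇒0≤γ {M = mat _ _ _ _} (_ , inj₂ (inj₂ (inj₂ (inj₁ (_ , 0≤γ , _)))))            = 0≤γ
𝓜⇒0≤γ {M = mat _ _ _ _} (_ , inj₂ (inj₂ (inj₂ (inj₂ (inj₁ (_ , _ , 0<γ , _)))))) = ℤP.<⇒≤ 0<γ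
𝓜⇒0≤γ {M = mat _ _ _ _} (_ , inj₂ (inj₂ (inj₂ (inj₂ (inj₂ (_ , _ , 0<γ , _)))))) = ℤP.<⇒≤ 0<γ

Continuant : Mat → Set
Continuant (mat p q r s) = (0ℤ ≤ p) × (0ℤ ≤ q) × (0ℤ ≤ r) × (r ≤ s) × (1ℤ ≤ s) × (p + r ≤ q + s)

JA-⊗ : ∀ d p q r s → J ⊗ A d ⊗ mat p q r s ≡ mat r s (p + d * r) (q + d * s)
JA-⊗ d p q r s = mat-cong (top d p r) (top d q s) (bottom d p r) (bottom d q s)
  where
  top : ∀ d p r → (0ℤ * 1ℤ + 1ℤ * 0ℤ) * p + (0ℤ * d + 1ℤ * 1ℤ) * r ≡ r
  top = solve-∀
  bottom : ∀ d p r → (1ℤ * 1ℤ + 0ℤ * 0ℤ) * p + (1ℤ * d + 0ℤ * 1ℤ) * r ≡ p + d * r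
  bottom = solve-∀

continuant-JA : ∀ {d} T → 1ℤ ≤ d → Continuant T → Continuant (J ⊗ A d ⊗ T)
continuant-JA {d} (mat p q r s) 1≤d (0≤p , 0≤q , 0≤r , r≤s , 1≤s , p+r≤q+s) =
  subst Continuant (sym (JA-⊗ d p q r s))
    ( 0≤r
    , 1≤⇒0≤ 1≤s
    , 0≤p ⟨+⟩ 1≤⇒0≤ 1≤d ⟨*⟩ 0≤r
    , ≤-by (0≤slack ⟨+⟩ ≤⇒0≤- 1≤d ⟨*⟩ ≤⇒0≤- r≤s) (expand₁ d p q r s)
    , ≤-by (0≤q ⟨+⟩ ≤⇒0≤- 1≤s ⟨+⟩ ≤⇒0≤- 1≤d ⟨*⟩ 1≤⇒0≤ 1≤s) (expand₂ d q s)
    , ≤-by (0≤slack ⟨+⟩ 1≤⇒0≤ 1≤d ⟨*⟩ ≤⇒0≤- r≤s) (expand₃ d p q r s) )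
  where
  0≤slack = ≤⇒0≤- p+r≤q+s
  expand₁ : ∀ d p q r s → (q + s - (p + r)) + (d - 1ℤ) * (s - r) ≡ q + d * s - (p + d * r)
  expand₁ = solve-∀
  expand₂ : ∀ d q s → q + (s - 1ℤ) + (d - 1ℤ) * s ≡ q + d * s - 1ℤ
  expand₂ = solve-∀
  expand₃ : ∀ d p q r s → (q + s - (p + r)) + d * (s - r) ≡ s + (q + d * s) - (r + (p + d * r))
  expand₃ = solve-∀

continuant-JAprod : ∀ ds → All Positive ds → Continuant (JAprod ds)
continuant-JAprod []       []         = +≤+ z≤n , +≤+ z≤n , +≤+ z≤n , +≤+ z≤n , +≤+ (s≤s z≤n) , +≤+ (s≤s z≤n)
continuant-JAprod (d ∷ ds) (1≤d ∷ ps) = continuant-JA (JAprod ds) (+≤+ 1≤d) (continuant-JAprod ds ps)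

second-row : ∀ {α β γ δ d₀ p q r s a b c d j} →
             mat α β γ δ ⊗ J ⊗ A j ≡ A d₀ ⊗ mat p q r s ⊗ mat a b c d →
             r * b + s * d ≡ (r * a + s * c) * j + γ
second-row {α} {β} {γ} {δ} {d₀} {p} {q} {r} {s} {a} {b} {c} {d} {j} eq = begin
  r * b + s * d                                     ≡⟨ sym (row p q r s b d) ⟩
  Mat.δ (A d₀ ⊗ mat p q r s ⊗ mat a b c d)          ≡⟨ sym (cong Mat.δ eq) ⟩
  Mat.δ (mat α β γ δ ⊗ J ⊗ A j)                     ≡⟨ left-δ γ δ j ⟩
  δ * j + γ                                         ≡⟨ cong (λ x → x * j + γ) δ≡ ⟩
  (r * a + s * c) * j + γ                           ∎
  where
  open ≡-Reasoning
  row : ∀ p q r s x y → (0ℤ * p + 1ℤ * r) * x + (0ℤ * q + 1ℤ * s) * y ≡ r * x + s * y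
  row = solve-∀
  left-γ : ∀ γ δ → (γ * 0ℤ + δ * 1ℤ) * 1ℤ + (γ * 1ℤ + δ * 0ℤ) * 0ℤ ≡ δ
  left-γ = solve-∀
  left-δ : ∀ γ δ j → (γ * 0ℤ + δ * 1ℤ) * j + (γ * 1ℤ + δ * 0ℤ) * 1ℤ ≡ δ * j + γ
  left-δ = solve-∀
  δ≡ : δ ≡ r * a + s * c
  δ≡ = trans (sym (left-γ γ δ)) (trans (cong Mat.γ eq) (row p q r s a c))

second-row-< : ∀ {n j γ a b c d r s} → 0ℤ ≤ n → 0ℤ ≤ γ → 0ℤ ≤ r → r ≤ s → 1ℤ ≤ s →
               b ≤ n → d ≤ n → 1ℤ ≤ c → 1ℤ ≤ a + c → 1ℤ + (n + n) ≤ j →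
               r * b + s * d < (r * a + s * c) * j + γ
second-row-< {n} {j} {γ} {a} {b} {c} {d} {r} {s} 0≤n 0≤γ 0≤r r≤s 1≤s b≤n d≤n 1≤c 1≤a+c 2n<j =
  <-by ((0≤excess ⟨+⟩ 1≤⇒0≤ 1≤s) ⟨*⟩ ≤⇒0≤- 2n<j ⟨+⟩ 0≤excess ⟨*⟩ 0≤2n+1 ⟨+⟩ ≤⇒0≤- 1≤s ⟨+⟩ 0≤γ
        ⟨+⟩ ≤⇒0≤- r≤s ⟨*⟩ 0≤n ⟨+⟩ 0≤r ⟨*⟩ ≤⇒0≤- b≤n ⟨+⟩ 1≤⇒0≤ 1≤s ⟨*⟩ ≤⇒0≤- d≤n)
       (certificate n j γ a b c d r s)
  where
  0≤excess : 0ℤ ≤ r * (a + c - 1ℤ) + (s - r) * (c - 1ℤ)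
  0≤excess = 0≤r ⟨*⟩ ≤⇒0≤- 1≤a+c ⟨+⟩ ≤⇒0≤- r≤s ⟨*⟩ ≤⇒0≤- 1≤c
  0≤2n+1 : 0ℤ ≤ 1ℤ + (n + n)
  0≤2n+1 = +≤+ z≤n ⟨+⟩ (0≤n ⟨+⟩ 0≤n)
  -- excess + s = r a + s c, the lower-left entry of M J A_j.
  certificate : ∀ n j γ a b c d r s →
    let excess = r * (a + c - 1ℤ) + (s - r) * (c - 1ℤ) in
    (excess + s) * (j - (1ℤ + (n + n))) + excess * (1ℤ + (n + n)) + (s - 1ℤ) + γ
      + (s - r) * n + r * (n - b) + s * (n - d)
    ≡ (r * a + s * c) * j + γ - (r * b + s * d) - 1ℤ
  certificate = solve-∀

large-letter⇒typeI : ∀ {D j d₀ M T Y} → suc (D ℕ.+ D) ℕ.≤ j → 𝓜 D M → Continuant T → 𝓜 D Y →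
                     M ⊗ J ⊗ A (+ j) ≡ A d₀ ⊗ T ⊗ Y → TypeI Y
large-letter⇒typeI {D} {j} {d₀} {mat α β γ δ} {mat p q r s} {mat a b c d}
                   2D<j 𝓜M (_ , _ , 0≤r , r≤s , 1≤s , _) 𝓜Y eq with 𝓜⇒typeI⊎bounded 𝓜Y
... | inj₁ typeI                       = typeI
... | inj₂ (b≤D , d≤D , 1≤c , 1≤a+c) =
  ⊥-elim (ℤP.<-irrefl (second-row {α} {β} {γ} {δ} {d₀} {p} {q} {r} {s} {a} {b} {c} {d} eq)
                      (second-row-< (+≤+ z≤n) (𝓜⇒0≤γ 𝓜M) 0≤r r≤s 1≤s b≤D d≤D 1≤c 1≤a+c 2D+1≤j))
  where
  2D+1≤j : 1ℤ + (+ D + + D) ≤ + j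
  2D+1≤j = subst (_≤ + j) (trans (ℤP.pos-+ 1 (D ℕ.+ D)) (cong (λ x → 1ℤ + x) (ℤP.pos-+ D D))) (+≤+ 2D<j)

triangular-stabiliser : ∀ {v₁ v₂ v₃ v₄ a b d a′ b′ d′} → 0ℤ < a → 0ℤ < d → 0ℤ < a′ → 0ℤ < d′ →
                        Unimodular (mat v₁ v₂ v₃ v₄) → mat v₁ v₂ v₃ v₄ ⊗ mat a b 0ℤ d ≡ mat a′ b′ 0ℤ d′ →
                        mat v₁ v₂ v₃ v₄ ≡ A v₂
triangular-stabiliser {v₁} {v₂} {v₃} {v₄} {a} {b} {d} {a′} {b′} {d′} 0<a 0<d 0<a′ 0<d′ uV eq =
  mat-cong v₁≡1 refl v₃≡0 v₄≡1
  where
  drop : ∀ x y → x + y * 0ℤ ≡ x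
  drop = solve-∀
  v₃≡0 : v₃ ≡ 0ℤ
  v₃≡0 with ℤP.i*j≡0⇒i≡0∨j≡0 v₃ (trans (sym (drop (v₃ * a) v₄)) (cong Mat.γ eq))
  ... | inj₁ v₃≡0 = v₃≡0
  ... | inj₂ a≡0  = ⊥-elim (ℤP.<-irrefl (sym a≡0) 0<a)
  0<v₁ : 0ℤ < v₁
  0<v₁ = positive-factor 0<a (subst (0ℤ <_) (sym (trans (sym (drop (v₁ * a) v₂)) (cong Mat.α eq))) 0<a′)
  0<v₄ : 0ℤ < v₄
  0<v₄ = positive-factor 0<d (subst (0ℤ <_) (sym v₄d≡d′) 0<d′)
    where
    drop-left : ∀ b y → 0ℤ * b + y ≡ y
    drop-left = solve-∀
    v₄d≡d′ : v₄ * d ≡ d′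
    v₄d≡d′ = trans (sym (drop-left b (v₄ * d))) (trans (cong (λ x → x * b + v₄ * d) (sym v₃≡0)) (cong Mat.δ eq))
  sign-v₁v₄ : Sign (v₁ * v₄)
  sign-v₁v₄ = subst Sign (trans (cong (λ x → v₁ * v₄ - v₂ * x) v₃≡0) (drop-det v₁ v₂ v₄)) uV
    where
    drop-det : ∀ v₁ v₂ v₄ → v₁ * v₄ - v₂ * 0ℤ ≡ v₁ * v₄
    drop-det = solve-∀
  v₁≡1 = positive-unit 0<v₁ 0<v₄ sign-v₁v₄
  v₄≡1 = positive-unit 0<v₄ 0<v₁ (subst Sign (ℤP.*-comm v₁ v₄) sign-v₁v₄)

typeI-unique : ∀ {Y Z} → TypeI Y → TypeI Z → Y ∼ Z → Y ≡ Z
typeI-unique {mat a b _ d} {mat a′ b′ _ d′} (refl , 0≤b , 0<a , 0<d , b<d) (refl , 0≤b′ , 0<a′ , 0<d′ , b′<d′)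
             (mat v₁ v₂ v₃ v₄ , uV , eq) = mat-cong a≡a′ b≡b′ refl d≡d′
  where
  eq′ : A v₂ ⊗ mat a b 0ℤ d ≡ mat a′ b′ 0ℤ d′
  eq′ = subst (λ V → V ⊗ mat a b 0ℤ d ≡ mat a′ b′ 0ℤ d′)
              (triangular-stabiliser {v₁} {v₂} {v₃} {v₄} {a} {b} {d} {a′} {b′} {d′} 0<a 0<d 0<a′ 0<d′ uV eq) eq
  a≡a′ : a ≡ a′
  a≡a′ = trans (sym (unit-α a v₂)) (cong Mat.α eq′)
    where
    unit-α : ∀ a v₂ → 1ℤ * a + v₂ * 0ℤ ≡ a
    unit-α = solve-∀
  d≡d′ : d ≡ d′
  d≡d′ = trans (sym (unit-δ b d)) (cong Mat.δ eq′)
    where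
    unit-δ : ∀ b d → 0ℤ * b + 1ℤ * d ≡ d
    unit-δ = solve-∀
  b+v₂d≡b′ : b + v₂ * d ≡ b′
  b+v₂d≡b′ = trans (sym (unit-β b v₂ d)) (cong Mat.β eq′)
    where
    unit-β : ∀ b v₂ d → 1ℤ * b + v₂ * d ≡ b + v₂ * d
    unit-β = solve-∀
  v₂≡0 : v₂ ≡ 0ℤ
  v₂≡0 = remainder-unique 0≤b b<d 0≤b′ (subst (b′ <_) (sym d≡d′) b′<d′) b+v₂d≡b′
  b≡b′ : b ≡ b′
  b≡b′ = trans (sym (no-shift b d)) (trans (cong (λ w → b + w * d) (sym v₂≡0)) b+v₂d≡b′)
    where
    no-shift : ∀ b d → b + 0ℤ * d ≡ b
    no-shift = solve-∀

Ustr-++ : ∀ U s t M → Ustr U (s ++ t) M ≡ Ustr U t (Ustr U s M)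
Ustr-++ U []      t M = refl
Ustr-++ U (c ∷ s) t M = Ustr-++ U s t (U c M)

Orbit : (ℕ → Mat → Mat) → Mat → Mat → Set
Orbit U Z M = Σ (List ℕ) λ t → Proper t × (Ustr U t Z ≡ M)

module _ {D : ℕ} {U : ℕ → Mat → Mat} (transition : IsTransition D U) where

  Ustr-𝓜 : ∀ s M → Proper s → 𝓜 D M → 𝓜 D (Ustr U s M)
  Ustr-𝓜 []      M []        𝓜M = 𝓜M
  Ustr-𝓜 (j ∷ s) M (pj ∷ ps) 𝓜M = Ustr-𝓜 s (U j M) ps (proj₁ (transition j M pj 𝓜M))

  U-∼ : ∀ j M → Positive j → 𝓜 D M → U j M ∼ M ⊗ J ⊗ A (+ j)
  U-∼ j M pj 𝓜M with transition j M pj 𝓜M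
  ... | _ , d₀ , ds , _ , _ , eq =
    A d₀ ⊗ JAprod ds , unimodular-⊗ {A d₀} {JAprod ds} (unimodular-A d₀) (unimodular-JAprod ds) , sym eq

  Ustr-∼ : ∀ s M → Proper s → 𝓜 D M → Ustr U s M ∼ M ⊗ prod (JAword s)
  Ustr-∼ []      M []        _  = ∼-reflexive (sym (⊗-identityʳ M))
  Ustr-∼ (j ∷ s) M (pj ∷ ps) 𝓜M = begin
    Ustr U s (U j M)                       ∼⟨ Ustr-∼ s (U j M) ps (proj₁ (transition j M pj 𝓜M)) ⟩
    U j M ⊗ prod (JAword s)                ∼⟨ ∼-⊗ʳ (prod (JAword s)) (U-∼ j M pj 𝓜M) ⟩
    M ⊗ J ⊗ A (+ j) ⊗ prod (JAword s)      ≡⟨ ⊗-assoc (M ⊗ J) (A (+ j)) (prod (JAword s)) ⟩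
    M ⊗ J ⊗ (A (+ j) ⊗ prod (JAword s))    ≡⟨ ⊗-assoc M J (A (+ j) ⊗ prod (JAword s)) ⟩
    M ⊗ prod (JAword (j ∷ s))              ∎
    where open ∼-Reasoning

  U-typeI : ∀ j M → suc (D ℕ.+ D) ℕ.≤ j → 𝓜 D M → TypeI (U j M)
  U-typeI j M 2D<j 𝓜M with transition j M (ℕP.≤-trans (s≤s z≤n) 2D<j) 𝓜M
  ... | 𝓜Y , d₀ , ds , _ , pds , eq = large-letter⇒typeI {d₀ = d₀} 2D<j 𝓜M (continuant-JAprod ds pds) 𝓜Y eq

module OrbitComponents (D′ : ℕ) (U : ℕ → Mat → Mat) (transition : IsTransition (suc D′) U) where

  D K P : ℕ
  D = suc D′
  K = suc (D ℕ.+ D)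
  P = D ℕ.* K

  q : ℕ → ℕ
  q j = P ℕ.+ D′ ℕ.* j

  j+q≡ : ∀ j → j ℕ.+ q j ≡ D ℕ.* (K ℕ.+ j)
  j+q≡ j = regroup j K D′
    where
    regroup : ∀ j K D′ → j ℕ.+ ((1 ℕ.+ D′) ℕ.* K ℕ.+ D′ ℕ.* j) ≡ (1 ℕ.+ D′) ℕ.* (K ℕ.+ j)
    regroup = ℕSolver.solve-∀

  undo : ℕ → List ℕ
  undo j = P ∷ q j ∷ P ∷ []

  inverse : List ℕ → List ℕ
  inverse []      = []
  inverse (j ∷ t) = inverse t ++ undo j

  -- The final letter P ≥ K makes the endpoint of a return trip of type I.
  return : List ℕ → List ℕ
  return t = inverse t ++ P ∷ P ∷ []

  inverse-proper : ∀ t → Proper (inverse t)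
  inverse-proper []      = []
  inverse-proper (j ∷ t) = ++⁺ (inverse-proper t) (s≤s z≤n ∷ s≤s z≤n ∷ s≤s z≤n ∷ [])

  return-proper : ∀ t → Proper (return t)
  return-proper t = ++⁺ (inverse-proper t) (s≤s z≤n ∷ s≤s z≤n ∷ [])

  undo-merge : ∀ j → prod (A (+ j) ∷ A (+ q j) ∷ []) ≡ prod (A (+ (D ℕ.* (K ℕ.+ j))) ∷ [])
  undo-merge j = begin
    A (+ j) ⊗ (A (+ q j) ⊗ I₂)     ≡⟨ cong (A (+ j) ⊗_) (⊗-identityʳ (A (+ q j))) ⟩
    A (+ j) ⊗ A (+ q j)            ≡⟨ A-+ (+ j) (+ q j) ⟩
    A (+ j + + q j)                ≡⟨ cong A (trans (sym (ℤP.pos-+ j (q j))) (cong +_ (j+q≡ j))) ⟩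
    A (+ (D ℕ.* (K ℕ.+ j)))        ≡⟨ sym (⊗-identityʳ _) ⟩
    A (+ (D ℕ.* (K ℕ.+ j))) ⊗ I₂   ∎
    where open ≡-Reasoning

  undo-absorbed : ∀ j → Absorbed D (JAword (j ∷ undo j))
  undo-absorbed j X dX = begin
    X ⊗ prod (J ∷ A (+ j) ∷ J ∷ A (+ P) ∷ J ∷ A (+ q j) ∷ J ∷ A (+ P) ∷ [])
      ∼⟨ absorbed-infix X (J ∷ A (+ j) ∷ J ∷ []) (A (+ P) ∷ []) (J ∷ A (+ q j) ∷ J ∷ A (+ P) ∷ [])
                        (A-multiple-absorbed K) dX (unimodular-J ∷ unimodular-A (+ j) ∷ unimodular-J ∷ []) ⟩
    X ⊗ prod (J ∷ A (+ j) ∷ J ∷ J ∷ A (+ q j) ∷ J ∷ A (+ P) ∷ [])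
      ≡⟨ cong (X ⊗_) (prod-infix (J ∷ A (+ j) ∷ []) (J ∷ J ∷ []) [] (A (+ q j) ∷ J ∷ A (+ P) ∷ []) refl) ⟩
    X ⊗ prod (J ∷ A (+ j) ∷ A (+ q j) ∷ J ∷ A (+ P) ∷ [])
      ≡⟨ cong (X ⊗_) (prod-infix (J ∷ []) (A (+ j) ∷ A (+ q j) ∷ []) (A (+ (D ℕ.* (K ℕ.+ j))) ∷ [])
                                 (J ∷ A (+ P) ∷ []) (undo-merge j)) ⟩
    X ⊗ prod (J ∷ A (+ (D ℕ.* (K ℕ.+ j))) ∷ J ∷ A (+ P) ∷ [])
      ∼⟨ multiples-absorbed (K ℕ.+ j) K X dX ⟩
    X ∎
    where open ∼-Reasoning

  cancel-inverse : ∀ X ws t u → Absorbed D (JAword (t ++ inverse t)) → Det± D X → All Unimodular ws →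
                   X ⊗ prod (ws ++ JAword (t ++ (inverse t ++ u))) ∼ X ⊗ prod (ws ++ JAword u)
  cancel-inverse X ws t u absorbed dX uws = begin
    X ⊗ prod (ws ++ JAword (t ++ (inverse t ++ u)))
      ≡⟨ cong (λ vs → X ⊗ prod (ws ++ vs)) regroup ⟩
    X ⊗ prod (ws ++ JAword (t ++ inverse t) ++ JAword u)
      ∼⟨ absorbed-infix X ws (JAword (t ++ inverse t)) (JAword u) absorbed dX uws ⟩
    X ⊗ prod (ws ++ JAword u) ∎
    where
    open ∼-Reasoning
    regroup : JAword (t ++ (inverse t ++ u)) ≡ JAword (t ++ inverse t) ++ JAword u
    regroup = trans (cong JAword (sym (Listₚ.++-assoc t (inverse t) u))) (JAword-++ (t ++ inverse t) u)

  inverse-absorbed : ∀ t → Absorbed D (JAword (t ++ inverse t))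
  inverse-absorbed []      X _  = ∼-reflexive (⊗-identityʳ X)
  inverse-absorbed (j ∷ t) X dX =
    ∼-trans (cancel-inverse X (J ∷ A (+ j) ∷ []) t (undo j) (inverse-absorbed t) dX
                            (unimodular-J ∷ unimodular-A (+ j) ∷ []))
            (undo-absorbed j X dX)

  return-absorbed : ∀ t → Absorbed D (JAword (t ++ return t))
  return-absorbed t X dX =
    ∼-trans (cancel-inverse X [] t (P ∷ P ∷ []) (inverse-absorbed t) dX []) (multiples-absorbed K K X dX)

  return-home : ∀ {Z} → 𝓜 D Z → TypeI Z → ∀ t → Proper t → Ustr U (return t) (Ustr U t Z) ≡ Z
  return-home {Z} 𝓜Z typeI-Z t pt =
    typeI-unique typeI-end typeI-Z (subst (_∼ Z) (Ustr-++ U t (return t) Z) round-trip)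
    where
    𝓜W : 𝓜 D (Ustr U (inverse t) (Ustr U t Z))
    𝓜W = Ustr-𝓜 transition (inverse t) (Ustr U t Z) (inverse-proper t) (Ustr-𝓜 transition t Z pt 𝓜Z)
    typeI-end : TypeI (Ustr U (return t) (Ustr U t Z))
    typeI-end = subst TypeI (sym (Ustr-++ U (inverse t) (P ∷ P ∷ []) (Ustr U t Z)))
                      (U-typeI transition P _ (ℕP.m≤m+n K (D′ ℕ.* K)) (proj₁ (transition P _ (s≤s z≤n) 𝓜W)))
    round-trip : Ustr U (t ++ return t) Z ∼ Z
    round-trip = ∼-trans (Ustr-∼ transition (t ++ return t) Z (++⁺ pt (return-proper t)) 𝓜Z)
                         (return-absorbed t Z (proj₁ 𝓜Z))

  orbit-component : ∀ {Z} → 𝓜 D Z → TypeI Z → IsTransitiveComponent D U (Orbit U Z)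
  orbit-component {Z} 𝓜Z typeI-Z = in-𝓜 , closed , transitive
    where
    in-𝓜 : ∀ M → Orbit U Z M → 𝓜 D M
    in-𝓜 M (t , pt , refl) = Ustr-𝓜 transition t Z pt 𝓜Z
    closed : ∀ s M → Proper s → Orbit U Z M → Orbit U Z (Ustr U s M)
    closed s M ps (t , pt , refl) = t ++ s , ++⁺ pt ps , Ustr-++ U t s Z
    transitive : ∀ M M′ → Orbit U Z M → Orbit U Z M′ → Σ (List ℕ) (λ s → Proper s × (Ustr U s M ≡ M′))
    transitive M M′ (t , pt , refl) (t′ , pt′ , refl) =
      return t ++ t′ , ++⁺ (return-proper t) pt′ ,
      trans (Ustr-++ U (return t) t′ (Ustr U t Z)) (cong (Ustr U t′) (return-home 𝓜Z typeI-Z t pt))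

diagonal-typeI : ∀ D → 1 ℕ.≤ D → TypeI (mat 1ℤ 0ℤ 0ℤ (+ D))
diagonal-typeI D 1≤D = refl , +≤+ z≤n , +<+ (s≤s z≤n) , +<+ 1≤D , +<+ 1≤D

diagonal-𝓜 : ∀ D → 1 ℕ.≤ D → 𝓜 D (mat 1ℤ 0ℤ 0ℤ (+ D))
diagonal-𝓜 D 1≤D = inj₁ (det-diagonal (+ D)) , inj₁ (diagonal-typeI D 1≤D)
  where
  det-diagonal : ∀ x → 1ℤ * x - 0ℤ * 0ℤ ≡ x
  det-diagonal = solve-∀

lemma4p1 : (D : ℕ) → 1 ℕ.≤ D → (U : ℕ → Mat → Mat) → IsTransition D U →
    (Σ (Mat → Set) (λ C → IsTransitiveComponent D U C × Σ Mat C)) ×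
    Σ (List ℕ) (λ s → Proper s ×
      (∀ M → 𝓜 D M → Σ (Mat → Set) (λ C → IsTransitiveComponent D U C × C (Ustr U s M))))
lemma4p1 D@(suc D′) 1≤D U transition =
  ( Orbit U M₀ , orbit-component (diagonal-𝓜 D 1≤D) (diagonal-typeI D 1≤D) , M₀ , [] , [] , refl )
  , K ∷ [] , s≤s z≤n ∷ []
  , λ M 𝓜M → Orbit U (U K M)
           , orbit-component (proj₁ (transition K M (s≤s z≤n) 𝓜M)) (U-typeI transition K M ℕP.≤-refl 𝓜M)
           , [] , [] , refl
  where
  open OrbitComponents D′ U transition using (K; orbit-component)
  M₀ = mat 1ℤ 0ℤ 0ℤ (+ D)
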